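{- Fix an integer $r \geq 3$. Let $G$ be an $r$-regular finite simple graph and $x$ a vertex of $G$. Then the point $\left( c_3(G,x)/3,\ c_4(G,x)/4 \right)$ lies under or on the segment connecting $P^r_0 = \left(0, \frac{r(r-1)^2}{8}\right)$ and $P^r_1 = \left(\frac{r(r-1)}{6}, \frac{r(r-1)(r-2)}{8}\right)$.
   Context: $c_k(G,x)$ denotes the number of $k$-cycles (cycles of length $k$, as subgraphs) of $G$ containing the vertex $x$. Note $P^r_0$ and $P^r_1$ are the points $(d_3,d_4)$ of $K_{r,r}$ and $K_{r+1}$ respectively, where $d_k$ is the number of $k$-cycles divided by the number of vertices. -}

module Defs where

open import Data.Nat as ℕ using (ℕ; suc; _∸_)
open import Data.Bool using (Bool; true; false; _∧_; not)
open import Data.Fin using (Fin; toℕ)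
open import Data.Fin.Properties using (_≟_)
open import Data.List using (List; map; allFin; filter; length)
open import Data.Nat.ListAction using (sum)
open import Data.Product using (_×_; _,_; ∃; proj₁; proj₂)
open import Data.Integer using (+_)
open import Data.Rational using (ℚ; _/_; _+_; _*_; _-_; _≤_; 0ℚ; 1ℚ)
open import Relation.Binary.PropositionalEquality using (_≡_)
open import Relation.Nullary.Decidable using (⌊_⌋)

record SimpleGraph (n : ℕ) : Set where
  field
    Adj   : Fin n → Fin n → Bool
    sym   : ∀ u v → Adj u v ≡ Adj v u
    irrefl : ∀ v → Adj v v ≡ false
open SimpleGraph public

count : ∀ {n} → (Fin n → Bool) → ℕ
count {n} P = length (filter (λ i → P i Data.Bool.≟ true) (allFin n))

_≢ᵇ_ : ∀ {n} → Fin n → Fin n → Bool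
u ≢ᵇ v = not ⌊ u ≟ v ⌋

_<ᵇ_ : ∀ {n} → Fin n → Fin n → Bool
u <ᵇ v = toℕ u ℕ.<ᵇ toℕ v

degree : ∀ {n} → SimpleGraph n → Fin n → ℕ
degree G v = count (Adj G v)

IsRegular : ∀ {n} → ℕ → SimpleGraph n → Set
IsRegular r G = ∀ v → degree G v ≡ r

-- c₃(G,x): number of triangles (3-cycles as subgraphs) containing x.
-- A triangle through x is {x,y,z} with x~y, x~z, y~z; it is counted once
-- via the ordering y < z.
c₃ : ∀ {n} → SimpleGraph n → Fin n → ℕ
c₃ {n} G x = sum (map (λ y → count (λ z →
  (y <ᵇ z) ∧ Adj G x y ∧ Adj G x z ∧ Adj G y z)) (allFin n))

-- A 4-cycle through x is x - y - z - w - x with x,y,z,w pairwise distinct;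
-- the two traversal directions (y,z,w) and (w,z,y) give the same subgraph,
-- so it is counted once via the ordering y < w.
c₄ : ∀ {n} → SimpleGraph n → Fin n → ℕ
c₄ {n} G x = sum (map (λ y → sum (map (λ z → count (λ w →
  (y <ᵇ w) ∧ (x ≢ᵇ y) ∧ (x ≢ᵇ z) ∧ (x ≢ᵇ w) ∧ (y ≢ᵇ z) ∧ (z ≢ᵇ w)
  ∧ Adj G x y ∧ Adj G y z ∧ Adj G z w ∧ Adj G w x)) (allFin n))) (allFin n))

ℕ/ : ℕ → (d : ℕ) → .{{_ : ℕ.NonZero d}} → ℚ
ℕ/ m d = (+ m) / d

Point : Set
Point = ℚ × ℚ

UnderOrOnSegment : Point → Point → Point → Set
UnderOrOnSegment (x₀ , y₀) (x₁ , y₁) (a , b) =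
  ∃ λ t → 0ℚ ≤ t × t ≤ 1ℚ
        × a ≡ (1ℚ - t) * x₀ + t * x₁
        × b ≤ (1ℚ - t) * y₀ + t * y₁

-- P^r_0 = (0, r(r-1)^2/8)   (the point of K_{r,r})
P₀ : ℕ → Point
P₀ r = (0ℚ , ℕ/ (r ℕ.* (r ∸ 1) ℕ.* (r ∸ 1)) 8)

-- P^r_1 = (r(r-1)/6, r(r-1)(r-2)/8)   (the point of K_{r+1})
P₁ : ℕ → Point
P₁ r = (ℕ/ (r ℕ.* (r ∸ 1)) 6 , ℕ/ (r ℕ.* (r ∸ 1) ℕ.* (r ∸ 2)) 8)

-- Let d(z) be the number of common neighbours of x and z. Counting the paths x - y - z
-- gives Σ_{z ≠ x} d(z) = r(r-1), while 2c₃ = Σ_{z ~ x} d(z) and 2c₄ = Σ_{z ≠ x} d(z)(d(z) - 1).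
-- For a common neighbour y of x and z ≠ x, the vertices of N(z) \ {y} include the other
-- d(z) - 1 common neighbours and, if z ~ x, also x; hence d(z) - 1 + [z ~ x] ≤ r - 1, and
-- 2c₄ + 2c₃ ≤ (r-1)·r(r-1). Together with 2c₃ ≤ r(r-1) (since d(z) ≤ r - 1 for z ~ x), this
-- places (c₃/3, c₄/4) under the segment, at parameter t = 2c₃/(r(r-1)).
module Submission where

open import Defs hiding (sym)
open import Data.Nat using (ℕ; _≥_; suc; s≤s; z≤n)
open import Data.Fin using (Fin)
open import Data.Product using (_,_)

module Fractions where

  open import Data.Nat as ℕ using (_∸_)
  import Data.Nat.Properties as ℕ
  import Data.Nat.Solver
  open import Data.Integer as ℤ using (+_)
  import Data.Integer.Properties as ℤ
  open import Data.Rational using (ℚ; 0ℚ; 1ℚ; _+_; _*_; _-_; _≤_; toℚᵘ)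
  import Data.Rational.Properties as ℚ
  import Data.Rational.Solver
  open import Data.Rational.Unnormalised using (mkℚᵘ; *≡*; *≤*) renaming (_≃_ to _≃ᵘ_; _+_ to _+ᵘ_; _*_ to _*ᵘ_)
  import Data.Rational.Unnormalised.Properties as ℚᵘ
  open import Relation.Binary.PropositionalEquality

  toℚᵘ-ℕ/ : ∀ a d → toℚᵘ (ℕ/ a (suc d)) ≃ᵘ mkℚᵘ (+ a) d
  toℚᵘ-ℕ/ a d = ℚ.toℚᵘ-fromℚᵘ (mkℚᵘ (+ a) d)

  ℕ/≡ℕ/ : ∀ a b {d e} → a ℕ.* suc e ≡ b ℕ.* suc d → ℕ/ a (suc d) ≡ ℕ/ b (suc e)
  ℕ/≡ℕ/ a b {d} {e} ae≡bd = ℚ.toℚᵘ-injective (begin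
    toℚᵘ (ℕ/ a (suc d))  ≈⟨ toℚᵘ-ℕ/ a d ⟩
    mkℚᵘ (+ a) d         ≈⟨ *≡* (trans (sym (ℤ.pos-* a (suc e))) (trans (cong +_ ae≡bd) (ℤ.pos-* b (suc d)))) ⟩
    mkℚᵘ (+ b) e         ≈⟨ ℚᵘ.≃-sym (toℚᵘ-ℕ/ b e) ⟩
    toℚᵘ (ℕ/ b (suc e))  ∎)
    where open ℚᵘ.≃-Reasoning

  ℕ/≤ℕ/ : ∀ a b {d e} → a ℕ.* suc e ℕ.≤ b ℕ.* suc d → ℕ/ a (suc d) ≤ ℕ/ b (suc e)
  ℕ/≤ℕ/ a b {d} {e} ae≤bd = ℚ.toℚᵘ-cancel-≤ (begin
    toℚᵘ (ℕ/ a (suc d))  ≃⟨ toℚᵘ-ℕ/ a d ⟩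
    mkℚᵘ (+ a) d         ≤⟨ *≤* (subst₂ ℤ._≤_ (ℤ.pos-* a (suc e)) (ℤ.pos-* b (suc d)) (ℤ.+≤+ ae≤bd)) ⟩
    mkℚᵘ (+ b) e         ≃⟨ ℚᵘ.≃-sym (toℚᵘ-ℕ/ b e) ⟩
    toℚᵘ (ℕ/ b (suc e))  ∎)
    where open ℚᵘ.≤-Reasoning

  ℕ/+ℕ/ : ∀ a b d e → ℕ/ a (suc d) + ℕ/ b (suc e) ≡ ℕ/ (a ℕ.* suc e ℕ.+ b ℕ.* suc d) (suc d ℕ.* suc e)
  ℕ/+ℕ/ a b d e = ℚ.toℚᵘ-injective (begin
    toℚᵘ (ℕ/ a (suc d) + ℕ/ b (suc e))                ≈⟨ ℚ.toℚᵘ-homo-+ (ℕ/ a (suc d)) (ℕ/ b (suc e)) ⟩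
    toℚᵘ (ℕ/ a (suc d)) +ᵘ toℚᵘ (ℕ/ b (suc e))        ≈⟨ ℚᵘ.+-cong (toℚᵘ-ℕ/ a d) (toℚᵘ-ℕ/ b e) ⟩
    mkℚᵘ (+ a) d +ᵘ mkℚᵘ (+ b) e                      ≈⟨ *≡* (cong (ℤ._* + (suc d ℕ.* suc e)) (sym numerator)) ⟩
    mkℚᵘ (+ (a ℕ.* suc e ℕ.+ b ℕ.* suc d)) (ℕ.pred (suc d ℕ.* suc e))
                                                      ≈⟨ ℚᵘ.≃-sym (toℚᵘ-ℕ/ _ _) ⟩
    toℚᵘ (ℕ/ (a ℕ.* suc e ℕ.+ b ℕ.* suc d) (suc d ℕ.* suc e))  ∎)
    where
    open ℚᵘ.≃-Reasoning
    numerator : + (a ℕ.* suc e ℕ.+ b ℕ.* suc d) ≡ + a ℤ.* + suc e ℤ.+ + b ℤ.* + suc d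
    numerator = trans (ℤ.pos-+ (a ℕ.* suc e) (b ℕ.* suc d)) (cong₂ ℤ._+_ (ℤ.pos-* a (suc e)) (ℤ.pos-* b (suc d)))

  ℕ/*ℕ/ : ∀ a b d e → ℕ/ a (suc d) * ℕ/ b (suc e) ≡ ℕ/ (a ℕ.* b) (suc d ℕ.* suc e)
  ℕ/*ℕ/ a b d e = ℚ.toℚᵘ-injective (begin
    toℚᵘ (ℕ/ a (suc d) * ℕ/ b (suc e))            ≈⟨ ℚ.toℚᵘ-homo-* (ℕ/ a (suc d)) (ℕ/ b (suc e)) ⟩
    toℚᵘ (ℕ/ a (suc d)) *ᵘ toℚᵘ (ℕ/ b (suc e))    ≈⟨ ℚᵘ.*-cong (toℚᵘ-ℕ/ a d) (toℚᵘ-ℕ/ b e) ⟩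
    mkℚᵘ (+ a) d *ᵘ mkℚᵘ (+ b) e                  ≈⟨ *≡* (cong (ℤ._* + (suc d ℕ.* suc e)) (sym (ℤ.pos-* a b))) ⟩
    mkℚᵘ (+ (a ℕ.* b)) (ℕ.pred (suc d ℕ.* suc e))  ≈⟨ ℚᵘ.≃-sym (toℚᵘ-ℕ/ _ _) ⟩
    toℚᵘ (ℕ/ (a ℕ.* b) (suc d ℕ.* suc e))         ∎)
    where open ℚᵘ.≃-Reasoning

  0≤ℕ/ : ∀ a d → 0ℚ ≤ ℕ/ a (suc d)
  0≤ℕ/ a d = ℕ/≤ℕ/ 0 a {0} {d} ℕ.z≤n

  1-ℕ/ : ∀ a d → a ℕ.≤ suc d → 1ℚ - ℕ/ a (suc d) ≡ ℕ/ (suc d ∸ a) (suc d)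
  1-ℕ/ a d a≤D = begin
    1ℚ - q        ≡⟨ cong (_- q) (sym p+q≡1) ⟩
    (p + q) - q   ≡⟨ solve 2 (λ p q → (p :+ q) :- q := p) refl p q ⟩
    p             ∎
    where
    open ≡-Reasoning
    open Data.Rational.Solver.+-*-Solver using (solve; _:=_; _:+_; _:-_)
    p q : ℚ
    p = ℕ/ (suc d ∸ a) (suc d)
    q = ℕ/ a (suc d)
    p+q≡1 : p + q ≡ 1ℚ
    p+q≡1 = begin
      p + q                                                        ≡⟨ ℕ/+ℕ/ (suc d ∸ a) a d d ⟩
      ℕ/ ((suc d ∸ a) ℕ.* suc d ℕ.+ a ℕ.* suc d) (suc d ℕ.* suc d)  ≡⟨ ℕ/≡ℕ/ ((suc d ∸ a) ℕ.* suc d ℕ.+ a ℕ.* suc d) 1 numerator ⟩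
      ℕ/ 1 1                                                       ∎
      where
      numerator : ((suc d ∸ a) ℕ.* suc d ℕ.+ a ℕ.* suc d) ℕ.* 1 ≡ 1 ℕ.* (suc d ℕ.* suc d)
      numerator = trans (ℕ.*-identityʳ _) (trans (sym (ℕ.*-distribʳ-+ (suc d) (suc d ∸ a) a))
        (trans (cong (ℕ._* suc d) (ℕ.m∸n+n≡m a≤D)) (sym (ℕ.*-identityˡ _))))

  -- The parameter is read off the abscissa, c₃/3 = t · r(r-1)/6; at that t the segment
  -- has ordinate (r(r-1)² - 2c₃)/8, so the ordinate bound is 2c₄ + 2c₃ ≤ r(r-1)².
  point-under-segment : ∀ k c₃ c₄ → let r = 2 ℕ.+ k in
    2 ℕ.* c₃ ℕ.≤ r ℕ.* (r ∸ 1) → 2 ℕ.* c₄ ℕ.+ 2 ℕ.* c₃ ℕ.≤ r ℕ.* (r ∸ 1) ℕ.* (r ∸ 1) →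
    UnderOrOnSegment (P₀ r) (P₁ r) (ℕ/ c₃ 3 , ℕ/ c₄ 4)
  point-under-segment k c₃ c₄ c≤K cycles = t , 0≤ℕ/ c _ , t≤1 , abscissa , ordinate
    where
    open Data.Nat.Solver.+-*-Solver using (solve; _:=_; _:+_; _:*_; con)
    K c s N : ℕ
    K = (2 ℕ.+ k) ℕ.* (1 ℕ.+ k)
    c = 2 ℕ.* c₃
    s = K ∸ c
    N = s ℕ.* (K ℕ.* (1 ℕ.+ k)) ℕ.* (K ℕ.* 8) ℕ.+ c ℕ.* (K ℕ.* k) ℕ.* (K ℕ.* 8)
    t : ℚ
    t = ℕ/ c K

    t≤1 : t ≤ 1ℚ
    t≤1 = ℕ/≤ℕ/ c 1 (subst₂ ℕ._≤_ (sym (ℕ.*-identityʳ c)) (sym (ℕ.*-identityˡ K)) c≤K)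

    abscissa : ℕ/ c₃ 3 ≡ (1ℚ - t) * 0ℚ + t * ℕ/ K 6
    abscissa = sym (begin
      (1ℚ - t) * 0ℚ + t * ℕ/ K 6  ≡⟨ cong (_+ t * ℕ/ K 6) (ℚ.*-zeroʳ (1ℚ - t)) ⟩
      0ℚ + t * ℕ/ K 6             ≡⟨ ℚ.+-identityˡ _ ⟩
      t * ℕ/ K 6                  ≡⟨ ℕ/*ℕ/ c K _ 5 ⟩
      ℕ/ (c ℕ.* K) (K ℕ.* 6)      ≡⟨ ℕ/≡ℕ/ (c ℕ.* K) c₃ (solve 2 (λ c₃ K → con 2 :* c₃ :* K :* con 3 := c₃ :* (K :* con 6)) refl c₃ K) ⟩
      ℕ/ c₃ 3                     ∎)
      where open ≡-Reasoning

    2c₄≤ : 2 ℕ.* c₄ ℕ.≤ s ℕ.* (1 ℕ.+ k) ℕ.+ c ℕ.* k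
    2c₄≤ = ℕ.+-cancelʳ-≤ c _ _ (subst (2 ℕ.* c₄ ℕ.+ c ℕ.≤_) K[1+k] cycles)
      where
      K[1+k] : K ℕ.* (1 ℕ.+ k) ≡ s ℕ.* (1 ℕ.+ k) ℕ.+ c ℕ.* k ℕ.+ c
      K[1+k] = trans (cong (ℕ._* (1 ℕ.+ k)) (sym (ℕ.m∸n+n≡m c≤K)))
        (solve 3 (λ s c k → (s :+ c) :* (con 1 :+ k) := s :* (con 1 :+ k) :+ c :* k :+ c) refl s c k)

    cross-multiplied : c₄ ℕ.* ((K ℕ.* 8) ℕ.* (K ℕ.* 8)) ℕ.≤ N ℕ.* 4
    cross-multiplied = begin
      c₄ ℕ.* ((K ℕ.* 8) ℕ.* (K ℕ.* 8))   ≡⟨ solve 2 (λ c₄ K → c₄ :* ((K :* con 8) :* (K :* con 8)) := con 2 :* c₄ :* (con 32 :* K :* K)) refl c₄ K ⟩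
      2 ℕ.* c₄ ℕ.* (32 ℕ.* K ℕ.* K)      ≤⟨ ℕ.*-monoˡ-≤ (32 ℕ.* K ℕ.* K) 2c₄≤ ⟩
      (s ℕ.* (1 ℕ.+ k) ℕ.+ c ℕ.* k) ℕ.* (32 ℕ.* K ℕ.* K)
        ≡⟨ solve 4 (λ s c k K → (s :* (con 1 :+ k) :+ c :* k) :* (con 32 :* K :* K)
                               := (s :* (K :* (con 1 :+ k)) :* (K :* con 8) :+ c :* (K :* k) :* (K :* con 8)) :* con 4) refl s c k K ⟩
      N ℕ.* 4                            ∎
      where open ℕ.≤-Reasoning

    ordinate : ℕ/ c₄ 4 ≤ (1ℚ - t) * ℕ/ (K ℕ.* (1 ℕ.+ k)) 8 + t * ℕ/ (K ℕ.* k) 8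
    ordinate = begin
      ℕ/ c₄ 4                                                               ≤⟨ ℕ/≤ℕ/ c₄ N cross-multiplied ⟩
      ℕ/ N ((K ℕ.* 8) ℕ.* (K ℕ.* 8))
        ≡⟨ sym (ℕ/+ℕ/ (s ℕ.* (K ℕ.* (1 ℕ.+ k))) (c ℕ.* (K ℕ.* k)) _ _) ⟩
      ℕ/ (s ℕ.* (K ℕ.* (1 ℕ.+ k))) (K ℕ.* 8) + ℕ/ (c ℕ.* (K ℕ.* k)) (K ℕ.* 8)
        ≡⟨ sym (cong₂ _+_ (ℕ/*ℕ/ s _ _ 7) (ℕ/*ℕ/ c _ _ 7)) ⟩
      ℕ/ s K * ℕ/ (K ℕ.* (1 ℕ.+ k)) 8 + t * ℕ/ (K ℕ.* k) 8
        ≡⟨ cong (λ u → u * ℕ/ (K ℕ.* (1 ℕ.+ k)) 8 + t * ℕ/ (K ℕ.* k) 8) (sym (1-ℕ/ c _ c≤K)) ⟩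
      (1ℚ - t) * ℕ/ (K ℕ.* (1 ℕ.+ k)) 8 + t * ℕ/ (K ℕ.* k) 8                 ∎
      where open ℚ.≤-Reasoning

module Counting where

  open import Data.Bool using (Bool; true; false; _∧_)
  import Data.Bool as Bool
  open import Data.Empty using (⊥-elim)
  open import Function using (_∘_)
  open import Data.Fin using (toℕ)
  open import Data.Fin.Properties using (_≟_)
  open import Data.List using (List; []; _∷_; map; allFin; filter; length)
  open import Data.List.Membership.Propositional using (_∈_)
  open import Data.List.Membership.Propositional.Properties using (∈-allFin)
  open import Data.List.Relation.Unary.Any using (here; there)
  open import Data.Nat using (zero; _+_; _*_; _∸_; _≤_; z≤n; s≤s)
  import Data.Nat as ℕ
  open import Data.Nat.ListAction using (sum)
  open import Data.Nat.Properties hiding (_≟_)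
  open import Data.Nat.Solver using (module +-*-Solver)
  open import Relation.Binary.PropositionalEquality
  open import Relation.Nullary using (yes; no)
  open import Relation.Nullary.Decidable using (⌊_⌋)
  open +-*-Solver using (solve; _:=_; _:+_; _:*_)

  χ : Bool → ℕ
  χ true  = 1
  χ false = 0

  χ-∧ : ∀ a b → χ (a ∧ b) ≡ χ a * χ b
  χ-∧ true  b = sym (+-identityʳ (χ b))
  χ-∧ false b = refl

  χ*-≤ : ∀ b m → χ b * m ≤ m
  χ*-≤ true  m = ≤-reflexive (+-identityʳ m)
  χ*-≤ false m = z≤n

  χ-∧-≤ : ∀ a b → χ (a ∧ b) ≤ χ b
  χ-∧-≤ a b = ≤-trans (≤-reflexive (χ-∧ a b)) (χ*-≤ a (χ b))

  χ*-monoʳ-≤ : ∀ b {m n} → (b ≡ true → m ≤ n) → χ b * m ≤ χ b * n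
  χ*-monoʳ-≤ true  m≤n = *-monoʳ-≤ 1 (m≤n refl)
  χ*-monoʳ-≤ false m≤n = z≤n

  χ-<ᵇ-irrefl : ∀ m → χ (m ℕ.<ᵇ m) ≡ 0
  χ-<ᵇ-irrefl zero    = refl
  χ-<ᵇ-irrefl (suc m) = χ-<ᵇ-irrefl m

  χ-<ᵇ-asym : ∀ m n → χ (m ℕ.<ᵇ n) + χ (n ℕ.<ᵇ m) ≤ 1
  χ-<ᵇ-asym zero    zero    = z≤n
  χ-<ᵇ-asym zero    (suc n) = s≤s z≤n
  χ-<ᵇ-asym (suc m) zero    = s≤s z≤n
  χ-<ᵇ-asym (suc m) (suc n) = χ-<ᵇ-asym m n

  ∑ : {A : Set} → List A → (A → ℕ) → ℕ
  ∑ xs f = sum (map f xs)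

  infixl 10 ∑
  syntax ∑ xs (λ a → e) = ∑[ a ∈ xs ] e

  module _ {A : Set} where

    ∑-cong : ∀ xs {f g : A → ℕ} → (∀ a → f a ≡ g a) → ∑ xs f ≡ ∑ xs g
    ∑-cong []       f≡g = refl
    ∑-cong (a ∷ xs) f≡g = cong₂ _+_ (f≡g a) (∑-cong xs f≡g)

    ∑-mono-≤ : ∀ xs {f g : A → ℕ} → (∀ a → f a ≤ g a) → ∑ xs f ≤ ∑ xs g
    ∑-mono-≤ []       f≤g = z≤n
    ∑-mono-≤ (a ∷ xs) f≤g = +-mono-≤ (f≤g a) (∑-mono-≤ xs f≤g)

    ∑-distrib-+ : ∀ xs (f g : A → ℕ) → ∑[ a ∈ xs ] (f a + g a) ≡ ∑ xs f + ∑ xs g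
    ∑-distrib-+ []       f g = refl
    ∑-distrib-+ (a ∷ xs) f g rewrite ∑-distrib-+ xs f g =
      solve 4 (λ p q r s → (p :+ q) :+ (r :+ s) := (p :+ r) :+ (q :+ s)) refl (f a) (g a) (∑ xs f) (∑ xs g)

    *-distribˡ-∑ : ∀ m xs (f : A → ℕ) → m * ∑ xs f ≡ ∑[ a ∈ xs ] (m * f a)
    *-distribˡ-∑ m []       f = *-zeroʳ m
    *-distribˡ-∑ m (a ∷ xs) f = trans (*-distribˡ-+ m (f a) (∑ xs f)) (cong (m * f a +_) (*-distribˡ-∑ m xs f))

    ∑-zero : (xs : List A) → ∑[ a ∈ xs ] 0 ≡ 0
    ∑-zero []       = refl
    ∑-zero (a ∷ xs) = ∑-zero xs

    ∈⇒≤∑ : ∀ {xs a} (f : A → ℕ) → a ∈ xs → f a ≤ ∑ xs f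
    ∈⇒≤∑ f (here refl)            = m≤m+n _ _
    ∈⇒≤∑ {b ∷ xs} f (there a∈xs) = ≤-trans (∈⇒≤∑ f a∈xs) (m≤n+m _ (f b))

  ∑-comm : ∀ {A B : Set} xs (ys : List B) (F : A → B → ℕ) →
    ∑[ a ∈ xs ] ∑[ b ∈ ys ] F a b ≡ ∑[ b ∈ ys ] ∑[ a ∈ xs ] F a b
  ∑-comm [] ys F = sym (∑-zero ys)
  ∑-comm (a ∷ xs) ys F rewrite ∑-comm xs ys F = sym (∑-distrib-+ ys (F a) (λ b → ∑[ a′ ∈ xs ] F a′ b))

  count≡∑χ : ∀ {n} (P : Fin n → Bool) → count P ≡ ∑[ v ∈ allFin n ] χ (P v)
  count≡∑χ {n} P = go (allFin n)
    where
    go : ∀ vs → length (filter (λ v → P v Bool.≟ true) vs) ≡ ∑[ v ∈ vs ] χ (P v)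
    go []       = refl
    go (v ∷ vs) with P v
    ... | true  = cong suc (go vs)
    ... | false = go vs

  module _ {n : ℕ} where

    V : List (Fin n)
    V = allFin n

    δ δᶜ δ< : Fin n → Fin n → ℕ
    δ  u v = χ ⌊ u ≟ v ⌋
    δᶜ u v = χ (u ≢ᵇ v)
    δ< u v = χ (u <ᵇ v)

    δ-refl : ∀ v → δ v v ≡ 1
    δ-refl v with v ≟ v
    ... | yes _  = refl
    ... | no v≢v = ⊥-elim (v≢v refl)

    δ-≢ : ∀ {u v} → u ≢ v → δ u v ≡ 0
    δ-≢ {u} {v} u≢v with u ≟ v
    ... | yes u≡v = ⊥-elim (u≢v u≡v)
    ... | no _    = refl

    δᶜ-refl : ∀ v → δᶜ v v ≡ 0
    δᶜ-refl v with v ≟ v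
    ... | yes _  = refl
    ... | no v≢v = ⊥-elim (v≢v refl)

    1≤∑δ : ∀ v → 1 ≤ ∑[ w ∈ V ] δ w v
    1≤∑δ v = ≤-trans (≤-reflexive (sym (δ-refl v))) (∈⇒≤∑ (λ w → δ w v) (∈-allFin v))

    δ<+δ>≤δᶜ : ∀ u v → δ< u v + δ< v u ≤ δᶜ u v
    δ<+δ>≤δᶜ u v with u ≟ v
    ... | yes refl = ≤-reflexive (cong₂ _+_ (χ-<ᵇ-irrefl (toℕ v)) (χ-<ᵇ-irrefl (toℕ v)))
    ... | no _     = χ-<ᵇ-asym (toℕ u) (toℕ v)

    2*∑<≤∑≢ : (F : Fin n → Fin n → ℕ) → (∀ u v → F u v ≡ F v u) →
      2 * ∑[ u ∈ V ] ∑[ v ∈ V ] (δ< u v * F u v) ≤ ∑[ u ∈ V ] ∑[ v ∈ V ] (δᶜ u v * F u v)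
    2*∑<≤∑≢ F F-sym = begin
      2 * S                                                         ≡⟨ cong (S +_) (+-identityʳ S) ⟩
      S + S                                                         ≡⟨ cong (S +_) S≡∑> ⟩
      S + ∑[ u ∈ V ] ∑[ v ∈ V ] (δ< v u * F u v)                      ≡⟨ sym (∑-distrib-+ V _ _) ⟩
      ∑[ u ∈ V ] (∑[ v ∈ V ] (δ< u v * F u v) + ∑[ v ∈ V ] (δ< v u * F u v))
                                                                    ≡⟨ ∑-cong V (λ u → sym (∑-distrib-+ V _ _)) ⟩
      ∑[ u ∈ V ] ∑[ v ∈ V ] (δ< u v * F u v + δ< v u * F u v)       ≤⟨ ∑-mono-≤ V (λ u → ∑-mono-≤ V (λ v → pair u v)) ⟩
      ∑[ u ∈ V ] ∑[ v ∈ V ] (δᶜ u v * F u v)                          ∎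
      where
      open ≤-Reasoning
      S = ∑[ u ∈ V ] ∑[ v ∈ V ] (δ< u v * F u v)
      S≡∑> : S ≡ ∑[ u ∈ V ] ∑[ v ∈ V ] (δ< v u * F u v)
      S≡∑> = trans (∑-comm V V (λ u v → δ< u v * F u v)) (∑-cong V (λ v → ∑-cong V (λ u → cong (δ< u v *_) (F-sym u v))))
      pair : ∀ u v → δ< u v * F u v + δ< v u * F u v ≤ δᶜ u v * F u v
      pair u v = ≤-trans (≤-reflexive (sym (*-distribʳ-+ (F u v) (δ< u v) (δ< v u)))) (*-monoˡ-≤ (F u v) (δ<+δ>≤δᶜ u v))

  module Graph {n : ℕ} (G : SimpleGraph n) where

    adj : Fin n → Fin n → ℕ
    adj u v = χ (Adj G u v)

    adj-sym : ∀ u v → adj u v ≡ adj v u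
    adj-sym u v = cong χ (SimpleGraph.sym G u v)

    adj-irrefl : ∀ v → adj v v ≡ 0
    adj-irrefl v = cong χ (irrefl G v)

    adj≡δᶜ*adj : ∀ u v → adj u v ≡ δᶜ u v * adj u v
    adj≡δᶜ*adj u v with u ≟ v
    ... | yes refl = adj-irrefl u
    ... | no _     = sym (+-identityʳ (adj u v))

    degree≡∑adj : ∀ u → degree G u ≡ ∑[ w ∈ V ] adj u w
    degree≡∑adj u = count≡∑χ (Adj G u)

    ∑≤degree∸1 : ∀ u v (f : Fin n → ℕ) → (∀ w → f w ≤ adj u w) → f v ≡ 0 → Adj G u v ≡ true →
      ∑ V f ≤ degree G u ∸ 1
    ∑≤degree∸1 u v f f≤adj fv≡0 u~v = m+n≤o⇒m≤o∸n (∑ V f) (begin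
      ∑ V f + 1                                ≤⟨ +-monoʳ-≤ (∑ V f) (1≤∑δ v) ⟩
      ∑ V f + ∑[ w ∈ V ] δ w v                  ≡⟨ sym (∑-distrib-+ V f (λ w → δ w v)) ⟩
      ∑[ w ∈ V ] (f w + δ w v)                  ≤⟨ ∑-mono-≤ V pointwise ⟩
      ∑[ w ∈ V ] adj u w                        ≡⟨ sym (degree≡∑adj u) ⟩
      degree G u                               ∎)
      where
      open ≤-Reasoning
      pointwise : ∀ w → f w + δ w v ≤ adj u w
      pointwise w with w ≟ v
      ... | yes refl = ≤-reflexive (trans (cong (_+ 1) fv≡0) (cong χ (sym u~v)))
      ... | no _     = ≤-trans (≤-reflexive (+-identityʳ (f w))) (f≤adj w)

    adj⇒≢ : ∀ {u v} → Adj G u v ≡ true → u ≢ v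
    adj⇒≢ {u} u~v refl with () ← trans (sym (irrefl G u)) u~v

    Adj-sym : ∀ {u v} → Adj G u v ≡ true → Adj G v u ≡ true
    Adj-sym {u} {v} u~v = trans (SimpleGraph.sym G v u) u~v

  module AtVertex {n : ℕ} (G : SimpleGraph n) (x : Fin n) where
    open Graph G

    common : Fin n → Fin n → ℕ
    common z y = adj x y * adj z y

    codegree : Fin n → ℕ
    codegree z = ∑[ y ∈ V ] common z y

    codegree-avoiding : Fin n → Fin n → ℕ
    codegree-avoiding z y = ∑[ w ∈ V ] (δᶜ y w * common z w)

    triangle : Fin n → Fin n → Bool
    triangle y z = (y <ᵇ z) ∧ Adj G x y ∧ Adj G x z ∧ Adj G y z

    cycle₄ : Fin n → Fin n → Fin n → Bool
    cycle₄ y z w = (y <ᵇ w) ∧ (x ≢ᵇ y) ∧ (x ≢ᵇ z) ∧ (x ≢ᵇ w) ∧ (y ≢ᵇ z) ∧ (z ≢ᵇ w)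
      ∧ Adj G x y ∧ Adj G y z ∧ Adj G z w ∧ Adj G w x

    2*c₃≤∑codegree : 2 * c₃ G x ≤ ∑[ y ∈ V ] (adj x y * codegree y)
    2*c₃≤∑codegree = begin
      2 * c₃ G x                                  ≡⟨ cong (2 *_) c₃≡∑ ⟩
      2 * ∑[ y ∈ V ] ∑[ z ∈ V ] (δ< y z * T y z)  ≤⟨ 2*∑<≤∑≢ T T-sym ⟩
      ∑[ y ∈ V ] ∑[ z ∈ V ] (δᶜ y z * T y z)      ≤⟨ ∑-mono-≤ V (λ y → ∑-mono-≤ V (λ z → χ*-≤ (y ≢ᵇ z) (T y z))) ⟩
      ∑[ y ∈ V ] ∑[ z ∈ V ] T y z                 ≡⟨ ∑-cong V (λ y → sym (*-distribˡ-∑ (adj x y) V (common y))) ⟩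
      ∑[ y ∈ V ] (adj x y * codegree y)           ∎
      where
      open ≤-Reasoning
      T : Fin n → Fin n → ℕ
      T y z = adj x y * common y z
      T-sym : ∀ y z → T y z ≡ T z y
      T-sym y z rewrite adj-sym y z = solve 3 (λ p q s → p :* (q :* s) := q :* (p :* s)) refl (adj x y) (adj x z) (adj z y)
      c₃≡∑ : c₃ G x ≡ ∑[ y ∈ V ] ∑[ z ∈ V ] (δ< y z * T y z)
      c₃≡∑ = ∑-cong V (λ y → trans (count≡∑χ (triangle y)) (∑-cong V (λ z →
        trans (χ-∧ (y <ᵇ z) _) (cong (δ< y z *_) (trans (χ-∧ (Adj G x y) _) (cong (adj x y *_) (χ-∧ (Adj G x z) (Adj G y z))))))))

    walk₄ : Fin n → Fin n → Fin n → ℕ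
    walk₄ z y w = δᶜ x z * common z y * common z w

    c₄-summand≤ : ∀ y z w → χ (cycle₄ y z w) ≤ δ< y w * walk₄ z y w
    c₄-summand≤ y z w = begin
      χ ((y <ᵇ w) ∧ (x ≢ᵇ y) ∧ (x ≢ᵇ z) ∧ (x ≢ᵇ w) ∧ (y ≢ᵇ z) ∧ (z ≢ᵇ w) ∧ walk)
        ≡⟨ χ-∧ (y <ᵇ w) _ ⟩
      δ< y w * χ ((x ≢ᵇ y) ∧ (x ≢ᵇ z) ∧ (x ≢ᵇ w) ∧ (y ≢ᵇ z) ∧ (z ≢ᵇ w) ∧ walk)
        ≤⟨ *-monoʳ-≤ (δ< y w) (χ-∧-≤ (x ≢ᵇ y) _) ⟩
      δ< y w * χ ((x ≢ᵇ z) ∧ (x ≢ᵇ w) ∧ (y ≢ᵇ z) ∧ (z ≢ᵇ w) ∧ walk)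
        ≡⟨ cong (δ< y w *_) (χ-∧ (x ≢ᵇ z) _) ⟩
      δ< y w * (δᶜ x z * χ ((x ≢ᵇ w) ∧ (y ≢ᵇ z) ∧ (z ≢ᵇ w) ∧ walk))
        ≤⟨ *-monoʳ-≤ (δ< y w) (*-monoʳ-≤ (δᶜ x z) (≤-trans (χ-∧-≤ (x ≢ᵇ w) _) (≤-trans (χ-∧-≤ (y ≢ᵇ z) _) (χ-∧-≤ (z ≢ᵇ w) walk)))) ⟩
      δ< y w * (δᶜ x z * χ walk)
        ≡⟨ cong (λ m → δ< y w * (δᶜ x z * m)) χ-walk ⟩
      δ< y w * (δᶜ x z * (common z y * common z w))         ≡⟨ cong (δ< y w *_) (sym (*-assoc (δᶜ x z) _ _)) ⟩
      δ< y w * walk₄ z y w                                      ∎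
      where
      open ≤-Reasoning
      walk : Bool
      walk = Adj G x y ∧ Adj G y z ∧ Adj G z w ∧ Adj G w x
      χ-walk : χ walk ≡ common z y * common z w
      χ-walk rewrite χ-∧ (Adj G x y) (Adj G y z ∧ Adj G z w ∧ Adj G w x) | χ-∧ (Adj G y z) (Adj G z w ∧ Adj G w x)
                   | χ-∧ (Adj G z w) (Adj G w x) | adj-sym y z | adj-sym w x =
        solve 4 (λ p q s t → p :* (q :* (s :* t)) := (p :* q) :* (t :* s)) refl (adj x y) (adj z y) (adj z w) (adj x w)

    2*c₄≤∑codegree-avoiding : 2 * c₄ G x ≤ ∑[ z ∈ V ] ∑[ y ∈ V ] (δᶜ x z * common z y * codegree-avoiding z y)
    2*c₄≤∑codegree-avoiding = begin
      2 * c₄ G x                                            ≤⟨ *-monoʳ-≤ 2 c₄≤ ⟩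
      2 * ∑[ y ∈ V ] ∑[ z ∈ V ] ∑[ w ∈ V ] (δ< y w * walk₄ z y w) ≡⟨ cong (2 *_) (∑-comm V V (λ y z → ∑[ w ∈ V ] (δ< y w * walk₄ z y w))) ⟩
      2 * ∑[ z ∈ V ] ∑[ y ∈ V ] ∑[ w ∈ V ] (δ< y w * walk₄ z y w) ≡⟨ *-distribˡ-∑ 2 V (λ z → ∑[ y ∈ V ] ∑[ w ∈ V ] (δ< y w * walk₄ z y w)) ⟩
      ∑[ z ∈ V ] (2 * ∑[ y ∈ V ] ∑[ w ∈ V ] (δ< y w * walk₄ z y w)) ≤⟨ ∑-mono-≤ V (λ z → 2*∑<≤∑≢ (walk₄ z) (walk₄-sym z)) ⟩
      ∑[ z ∈ V ] ∑[ y ∈ V ] ∑[ w ∈ V ] (δᶜ y w * walk₄ z y w)     ≡⟨ ∑-cong V (λ z → ∑-cong V (λ y → factor z y)) ⟩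
      ∑[ z ∈ V ] ∑[ y ∈ V ] (δᶜ x z * common z y * codegree-avoiding z y) ∎
      where
      open ≤-Reasoning
      c₄≤ : c₄ G x ≤ ∑[ y ∈ V ] ∑[ z ∈ V ] ∑[ w ∈ V ] (δ< y w * walk₄ z y w)
      c₄≤ = ∑-mono-≤ V (λ y → ∑-mono-≤ V (λ z → ≤-trans (≤-reflexive (count≡∑χ (cycle₄ y z))) (∑-mono-≤ V (c₄-summand≤ y z))))
      walk₄-sym : ∀ z y w → walk₄ z y w ≡ walk₄ z w y
      walk₄-sym z y w = solve 3 (λ d p q → d :* p :* q := d :* q :* p) refl (δᶜ x z) (common z y) (common z w)
      factor : ∀ z y → ∑[ w ∈ V ] (δᶜ y w * walk₄ z y w) ≡ δᶜ x z * common z y * codegree-avoiding z y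
      factor z y = trans (∑-cong V (λ w → solve 4 (λ e d p q → e :* (d :* p :* q) := d :* p :* (e :* q)) refl (δᶜ y w) (δᶜ x z) (common z y) (common z w)))
                         (sym (*-distribˡ-∑ (δᶜ x z * common z y) V (λ w → δᶜ y w * common z w)))

  module Regular {n : ℕ} (G : SimpleGraph n) (r : ℕ) (reg : IsRegular r G) (x : Fin n) where
    open Graph G
    open AtVertex G x

    ∑≤r∸1 : ∀ u v (f : Fin n → ℕ) → (∀ w → f w ≤ adj u w) → f v ≡ 0 → Adj G u v ≡ true → ∑ V f ≤ r ∸ 1
    ∑≤r∸1 u v f f≤adj fv≡0 u~v = subst (λ d → ∑ V f ≤ d ∸ 1) (reg u) (∑≤degree∸1 u v f f≤adj fv≡0 u~v)

    ∑adj* : ∀ u m → ∑[ w ∈ V ] (adj u w * m) ≡ r * m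
    ∑adj* u m = begin
      ∑[ w ∈ V ] (adj u w * m)   ≡⟨ ∑-cong V (λ w → *-comm (adj u w) m) ⟩
      ∑[ w ∈ V ] (m * adj u w)   ≡⟨ sym (*-distribˡ-∑ m V (adj u)) ⟩
      m * ∑[ w ∈ V ] adj u w     ≡⟨ cong (m *_) (trans (sym (degree≡∑adj u)) (reg u)) ⟩
      m * r                      ≡⟨ *-comm m r ⟩
      r * m                      ∎
      where open ≡-Reasoning

    codegree≤ : ∀ {y} → Adj G x y ≡ true → codegree y ≤ r ∸ 1
    codegree≤ {y} x~y = ∑≤r∸1 y x (common y) (λ z → χ*-≤ (Adj G x z) (adj y z))
      (cong (_* adj y x) (adj-irrefl x)) (Adj-sym x~y)

    codegree-avoiding+adj≤ : ∀ {y z} → Adj G x y ≡ true → Adj G z y ≡ true → codegree-avoiding z y + adj x z ≤ r ∸ 1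
    codegree-avoiding+adj≤ {y} {z} x~y z~y = begin
      codegree-avoiding z y + adj x z                     ≤⟨ +-monoʳ-≤ (codegree-avoiding z y) adj≤adj*∑δ ⟩
      codegree-avoiding z y + adj x z * ∑[ w ∈ V ] δ w x   ≡⟨ cong (codegree-avoiding z y +_) (*-distribˡ-∑ (adj x z) V (λ w → δ w x)) ⟩
      codegree-avoiding z y + ∑[ w ∈ V ] (adj x z * δ w x) ≡⟨ sym (∑-distrib-+ V (λ w → δᶜ y w * common z w) (λ w → adj x z * δ w x)) ⟩
      ∑ V f                                               ≤⟨ ∑≤r∸1 z y f f≤adj fy≡0 z~y ⟩
      r ∸ 1                                               ∎
      where
      open ≤-Reasoning
      adj≤adj*∑δ : adj x z ≤ adj x z * ∑[ w ∈ V ] δ w x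
      adj≤adj*∑δ = ≤-trans (≤-reflexive (sym (*-identityʳ (adj x z)))) (*-monoʳ-≤ (adj x z) (1≤∑δ x))
      f : Fin n → ℕ
      f w = δᶜ y w * common z w + adj x z * δ w x
      f≤adj : ∀ w → f w ≤ adj z w
      f≤adj w with w ≟ x
      ... | yes refl = ≤-reflexive (cong₂ _+_
        (trans (cong (λ a → δᶜ y w * (a * adj z w)) (adj-irrefl w)) (*-zeroʳ (δᶜ y w)))
        (trans (*-identityʳ (adj w z)) (adj-sym w z)))
      ... | no _ = ≤-trans (≤-reflexive (trans (cong (δᶜ y w * common z w +_) (*-zeroʳ (adj x z))) (+-identityʳ _)))
        (≤-trans (χ*-≤ (y ≢ᵇ w) (common z w)) (χ*-≤ (Adj G x w) (adj z w)))
      fy≡0 : f y ≡ 0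
      fy≡0 rewrite δᶜ-refl y | δ-≢ (adj⇒≢ x~y ∘ sym) = *-zeroʳ (adj x z)

    other-neighbours≤ : ∀ {y} → Adj G x y ≡ true → ∑[ z ∈ V ] (δᶜ x z * adj z y) ≤ r ∸ 1
    other-neighbours≤ {y} x~y = ∑≤r∸1 y x (λ z → δᶜ x z * adj z y)
      (λ z → ≤-trans (χ*-≤ (x ≢ᵇ z) (adj z y)) (≤-reflexive (adj-sym z y))) (cong (_* adj x y) (δᶜ-refl x)) (Adj-sym x~y)

    two-paths≤ : ∑[ z ∈ V ] ∑[ y ∈ V ] (δᶜ x z * common z y) ≤ r * (r ∸ 1)
    two-paths≤ = begin
      ∑[ z ∈ V ] ∑[ y ∈ V ] (δᶜ x z * common z y)          ≡⟨ ∑-comm V V (λ z y → δᶜ x z * common z y) ⟩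
      ∑[ y ∈ V ] ∑[ z ∈ V ] (δᶜ x z * common z y)          ≡⟨ ∑-cong V factor ⟩
      ∑[ y ∈ V ] (adj x y * ∑[ z ∈ V ] (δᶜ x z * adj z y)) ≤⟨ ∑-mono-≤ V (λ y → χ*-monoʳ-≤ (Adj G x y) other-neighbours≤) ⟩
      ∑[ y ∈ V ] (adj x y * (r ∸ 1))                       ≡⟨ ∑adj* x (r ∸ 1) ⟩
      r * (r ∸ 1)                                          ∎
      where
      open ≤-Reasoning
      factor : ∀ y → ∑[ z ∈ V ] (δᶜ x z * common z y) ≡ adj x y * ∑[ z ∈ V ] (δᶜ x z * adj z y)
      factor y = trans (∑-cong V (λ z → solve 3 (λ d p q → d :* (p :* q) := p :* (d :* q)) refl (δᶜ x z) (adj x y) (adj z y)))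
                       (sym (*-distribˡ-∑ (adj x y) V (λ z → δᶜ x z * adj z y)))

    2*c₃≤ : 2 * c₃ G x ≤ r * (r ∸ 1)
    2*c₃≤ = begin
      2 * c₃ G x                          ≤⟨ 2*c₃≤∑codegree ⟩
      ∑[ y ∈ V ] (adj x y * codegree y)   ≤⟨ ∑-mono-≤ V (λ y → χ*-monoʳ-≤ (Adj G x y) codegree≤) ⟩
      ∑[ y ∈ V ] (adj x y * (r ∸ 1))      ≡⟨ ∑adj* x (r ∸ 1) ⟩
      r * (r ∸ 1)                         ∎
      where open ≤-Reasoning

    2*c₄+2*c₃≤ : 2 * c₄ G x + 2 * c₃ G x ≤ r * (r ∸ 1) * (r ∸ 1)
    2*c₄+2*c₃≤ = begin
      2 * c₄ G x + 2 * c₃ G x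
        ≤⟨ +-mono-≤ 2*c₄≤∑codegree-avoiding 2*c₃≤∑codegree ⟩
      ∑[ z ∈ V ] ∑[ y ∈ V ] (δᶜ x z * common z y * codegree-avoiding z y) + ∑[ z ∈ V ] (adj x z * codegree z)
        ≡⟨ trans (sym (∑-distrib-+ V _ (λ z → adj x z * codegree z))) (∑-cong V merge) ⟩
      ∑[ z ∈ V ] ∑[ y ∈ V ] (δᶜ x z * common z y * codegree-avoiding z y + adj x z * common z y)
        ≤⟨ ∑-mono-≤ V (λ z → ∑-mono-≤ V (pair z)) ⟩
      ∑[ z ∈ V ] ∑[ y ∈ V ] ((r ∸ 1) * (δᶜ x z * common z y))
        ≡⟨ trans (∑-cong V (λ z → sym (*-distribˡ-∑ (r ∸ 1) V (λ y → δᶜ x z * common z y))))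
                 (sym (*-distribˡ-∑ (r ∸ 1) V (λ z → ∑[ y ∈ V ] (δᶜ x z * common z y)))) ⟩
      (r ∸ 1) * ∑[ z ∈ V ] ∑[ y ∈ V ] (δᶜ x z * common z y)
        ≤⟨ *-monoʳ-≤ (r ∸ 1) two-paths≤ ⟩
      (r ∸ 1) * (r * (r ∸ 1))
        ≡⟨ solve 2 (λ r r-1 → r-1 :* (r :* r-1) := r :* r-1 :* r-1) refl r (r ∸ 1) ⟩
      r * (r ∸ 1) * (r ∸ 1)
        ∎
      where
      open ≤-Reasoning
      merge : ∀ z → ∑[ y ∈ V ] (δᶜ x z * common z y * codegree-avoiding z y) + adj x z * codegree z
                  ≡ ∑[ y ∈ V ] (δᶜ x z * common z y * codegree-avoiding z y + adj x z * common z y)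
      merge z = trans (cong (∑[ y ∈ V ] (δᶜ x z * common z y * codegree-avoiding z y) +_) (*-distribˡ-∑ (adj x z) V (common z)))
                      (sym (∑-distrib-+ V (λ y → δᶜ x z * common z y * codegree-avoiding z y) (λ y → adj x z * common z y)))
      pair : ∀ z y → δᶜ x z * common z y * codegree-avoiding z y + adj x z * common z y ≤ (r ∸ 1) * (δᶜ x z * common z y)
      pair z y = begin
        δᶜ x z * common z y * S + adj x z * common z y
          ≡⟨ cong (λ a → δᶜ x z * common z y * S + a * common z y) (adj≡δᶜ*adj x z) ⟩
        δᶜ x z * common z y * S + δᶜ x z * adj x z * common z y
          ≡⟨ solve 5 (λ d p q s a → d :* (p :* q) :* s :+ d :* a :* (p :* q) := d :* (p :* (q :* (s :+ a)))) refl
               (δᶜ x z) (adj x y) (adj z y) S (adj x z) ⟩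
        δᶜ x z * (adj x y * (adj z y * (S + adj x z)))
          ≤⟨ *-monoʳ-≤ (δᶜ x z) (χ*-monoʳ-≤ (Adj G x y) (λ x~y → χ*-monoʳ-≤ (Adj G z y) (codegree-avoiding+adj≤ x~y))) ⟩
        δᶜ x z * (adj x y * (adj z y * (r ∸ 1)))
          ≡⟨ solve 4 (λ d p q m → d :* (p :* (q :* m)) := m :* (d :* (p :* q))) refl (δᶜ x z) (adj x y) (adj z y) (r ∸ 1) ⟩
        (r ∸ 1) * (δᶜ x z * common z y)
          ∎
        where
        S : ℕ
        S = codegree-avoiding z y

open Fractions using (point-under-segment)

proposition4p2 : (r : ℕ) → r ≥ 3 → {n : ℕ} (G : SimpleGraph n) → IsRegular r G → (x : Fin n) →
    UnderOrOnSegment (P₀ r) (P₁ r) (ℕ/ (c₃ G x) 3 , ℕ/ (c₄ G x) 4)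
proposition4p2 (suc (suc (suc k))) (s≤s (s≤s (s≤s z≤n))) G reg x =
  point-under-segment (suc k) (c₃ G x) (c₄ G x) 2*c₃≤ 2*c₄+2*c₃≤
  where open Counting.Regular G (suc (suc (suc k))) reg x using (2*c₃≤; 2*c₄+2*c₃≤)
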